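{- Let $\mathbb{F}_q$ be a finite field and $f \in \mathbb{F}_q[t]$. The following are equivalent: (a) $f$ is a WSC polynomial. (b) $f$ is weakly WSC, and for all $y \in f(\mathbb{F}_q)$ we have $e(y) \varphi'(y) = C(f)$, where $C(f) := \sum_{x \in \mathbb{F}_q} f(x)^{u(f)}$, and $C(f)\in \mathbb{F}_q^{\times}$. (c) There is $C \in \mathbb{F}_q^{\times}$ such that $e(y) \varphi'(y) = C$ for all $y \in f(\mathbb{F}_q)$.
   Context: For $f \in \mathbb{F}_q[t]$, $u(f)$ denotes the least positive integer $\delta$ such that $\sum_{x \in \mathbb{F}_q} f(x)^{\delta} \neq 0$ if such $\delta$ exists, and $u(f)=\infty$ otherwise. $f$ is weakly WSC if $u(f)<\infty$, and WSC if $u(f)=\# f(\mathbb{F}_q)-1$, where $f(\mathbb{F}_q)=\{f(x)\mid x\in\mathbb{F}_q\}$ is the value set. For $y\in f(\mathbb{F}_q)$, $e(y)=\#\{x\in\mathbb{F}_q\mid f(x)=y\}$ (viewed as an element of $\mathbb{F}_q$ in the products), and $\varphi(t)=\prod_{y\in f(\mathbb{F}_q)}(t-y)$, with $\varphi'$ its formal derivative. -}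

module Defs where

open import Level using (0ℓ)
open import Data.Nat as ℕ using (ℕ; zero; suc)
open import Data.List using (List; []; _∷_; map; foldr; filter; length; deduplicate)
open import Data.List.Membership.Propositional using (_∈_)
open import Data.List.Relation.Unary.Unique.Propositional using (Unique)
open import Data.Product using (Σ; _×_; ∃-syntax)
open import Relation.Nullary using (¬_; Dec)
open import Relation.Binary.PropositionalEquality using (_≡_)
open import Algebra.Structures using (IsCommutativeRing)

record FiniteField : Set₁ where
  infixl 6 _+_ _-_
  infixl 7 _*_
  field
    Carrier  : Set
    _+_ _*_  : Carrier → Carrier → Carrier
    -_       : Carrier → Carrier
    0# 1#    : Carrier
    isCommutativeRing : IsCommutativeRing _≡_ _+_ _*_ -_ 0# 1#
    0≢1      : ¬ (0# ≡ 1#)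
    inverse  : ∀ x → ¬ (x ≡ 0#) → Σ Carrier (λ y → x * y ≡ 1#)
    _≟_      : (x y : Carrier) → Dec (x ≡ y)
    elems    : List Carrier
    elems-unique   : Unique elems
    elems-complete : ∀ x → x ∈ elems

  _-_ : Carrier → Carrier → Carrier
  x - y = x + (- y)

module _ (F : FiniteField) where
  open FiniteField F

  -- polynomials over F as coefficient lists, lowest degree first
  Poly : Set
  Poly = List Carrier

  eval : Poly → Carrier → Carrier
  eval []       x = 0#
  eval (a ∷ as) x = a + x * eval as x

  ℕ→F : ℕ → Carrier
  ℕ→F zero    = 0#
  ℕ→F (suc n) = 1# + ℕ→F n

  _^_ : Carrier → ℕ → Carrier
  x ^ zero  = 1#
  x ^ suc n = x * (x ^ n)

  padd : Poly → Poly → Poly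
  padd []       q        = q
  padd p        []       = p
  padd (a ∷ p) (b ∷ q)   = (a + b) ∷ padd p q

  pscale : Carrier → Poly → Poly
  pscale c = map (c *_)

  pmul : Poly → Poly → Poly
  pmul []      q = []
  pmul (a ∷ p) q = padd (pscale a q) (0# ∷ pmul p q)

  derivFrom : ℕ → Poly → Poly
  derivFrom i []      = []
  derivFrom i (a ∷ p) = (ℕ→F i * a) ∷ derivFrom (suc i) p

  deriv : Poly → Poly
  deriv []      = []
  deriv (a ∷ p) = derivFrom 1 p

  sumF : (Carrier → Carrier) → Carrier
  sumF g = foldr (λ x s → g x + s) 0# elems

  powerSum : Poly → ℕ → Carrier
  powerSum f δ = sumF (λ x → eval f x ^ δ)

  valueSet : Poly → List Carrier
  valueSet f = deduplicate _≟_ (map (eval f) elems)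

  e : Poly → Carrier → ℕ
  e f y = length (filter (λ x → eval f x ≟ y) elems)

  φ : Poly → Poly
  φ f = foldr (λ y p → pmul ((- y) ∷ 1# ∷ []) p) (1# ∷ []) (valueSet f)

  -- u(f) = δ  (u(f) finite and equal to δ): δ is the least positive integer
  -- with S_δ(f) ≠ 0
  IsU : Poly → ℕ → Set
  IsU f δ = (1 ℕ.≤ δ) × ¬ (powerSum f δ ≡ 0#)
          × (∀ δ' → 1 ℕ.≤ δ' → δ' ℕ.< δ → powerSum f δ' ≡ 0#)

  -- weakly WSC: u(f) < ∞
  WeaklyWSC : Poly → Set
  WeaklyWSC f = ∃[ δ ] (1 ℕ.≤ δ × ¬ (powerSum f δ ≡ 0#))

  WSC : Poly → Set
  WSC f = IsU f (length (valueSet f) ℕ.∸ 1)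

-- Let Λ h = Σ_{x ∈ F_q} h (f x). Then Λ is linear, Λ (z ↦ z^m) = S_m(f), and S_0 = q · 1 = 0.
-- For y in the value set V, the cofactor ℓ_y z = ∏_{w ∈ V, w ≠ y} (z − w) vanishes on V ∖ {y}
-- and equals φ′(y) at y, so e(y) φ′(y) = Λ ℓ_y.
-- Since ℓ_y is monic of degree |V| − 1, Λ ℓ_y = S_{|V|−1} as soon as S_1, …, S_{|V|−2} vanish;
-- this gives (a) ⇒ (b).
-- Conversely, if Λ ℓ_y = C for every y, induction on |V| (passing from Λ to h ↦ Λ ((z − a) h))
-- shows S_m = 0 for m < |V| − 1 and S_{|V|−1} = C; as S_0 = 0 ≠ C, this forces u(f) = |V| − 1.

module Submission where

open import Defs renaming (_^_ to pow)
open import Data.Nat as ℕ using (ℕ; zero; suc; _<_; _∸_; z≤n; s≤s)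
import Data.Nat.Properties as ℕ
open import Data.List using (List; []; _∷_; map; foldr; filter; length)
open import Data.List.Properties using (foldr-map; length-removeAt′)
open import Data.List.Membership.Propositional using (_∈_; _─_)
open import Data.List.Membership.Propositional.Properties using (∈-map⁺; ∈-deduplicate⁺)
open import Data.List.Membership.Propositional.Properties.WithK using (unique∧set⇒bag)
open import Data.List.Relation.Unary.Any using (here; there)
open import Data.List.Relation.Unary.All using (_∷_)
open import Data.List.Relation.Unary.AllPairs using (_∷_)
open import Data.List.Relation.Unary.Unique.Propositional using (Unique)
import Data.List.Relation.Unary.Unique.Propositional.Properties as Unique
open import Data.List.Relation.Unary.Unique.DecPropositional.Properties using (deduplicate-!)
open import Data.List.Relation.Binary.BagAndSetEquality using (∼bag⇒↭)
open import Data.List.Relation.Binary.Permutation.Propositional using (_↭_; ↭⇒↭ₛ)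
import Data.List.Relation.Binary.Permutation.Propositional.Properties as Perm
import Data.List.Relation.Binary.Permutation.Setoid.Properties as PermSetoid
open import Data.Product using (_×_; ∃-syntax; _,_; proj₁; proj₂)
open import Relation.Nullary using (¬_; yes; no; contradiction)
open import Relation.Binary.PropositionalEquality
open import Function.Bundles using (_⇔_; mk⇔)
open import Algebra.Bundles using (CommutativeRing)
import Algebra.Properties.Group as GroupProperties
import Algebra.Properties.CommutativeSemigroup as CommutativeSemigroupProperties

module _ (F : FiniteField) where
  open FiniteField F
  open ≡-Reasoning

  commutativeRing : CommutativeRing _ _
  commutativeRing = record { isCommutativeRing = isCommutativeRing }

  open CommutativeRing commutativeRing
    using ( +-assoc; distribˡ; distribʳ
          ; +-identityˡ; +-identityʳ; *-identityˡ; zeroˡ; zeroʳ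
          ; -‿inverseˡ; -‿inverseʳ; +-group; +-isCommutativeMonoid; commutativeSemiring
          ; *-commutativeSemigroup )
  open GroupProperties +-group using (identityʳ-unique; x∙y⁻¹≈ε⇒x≈y; ∙-cancelʳ)
  open CommutativeSemigroupProperties *-commutativeSemigroup using (x∙yz≈y∙xz)
  open import Algebra.Solver.Ring.NaturalCoefficients.Default commutativeSemiring

  infixr 8 _^_
  _^_ : Carrier → ℕ → Carrier
  x ^ n = pow F x n

  nonzero-cancelˡ : ∀ {a x} → ¬ a ≡ 0# → a * x ≡ 0# → x ≡ 0#
  nonzero-cancelˡ {a} {x} a≢0 ax≡0 with inverse a a≢0
  ... | a⁻¹ , aa⁻¹≡1 = begin
    x                ≡⟨ sym (*-identityˡ x) ⟩
    1# * x           ≡⟨ cong (_* x) (sym aa⁻¹≡1) ⟩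
    (a * a⁻¹) * x    ≡⟨ solve 3 (λ a b x → (a :* b) :* x := b :* (a :* x)) refl a a⁻¹ x ⟩
    a⁻¹ * (a * x)    ≡⟨ cong (a⁻¹ *_) ax≡0 ⟩
    a⁻¹ * 0#         ≡⟨ zeroʳ a⁻¹ ⟩
    0#               ∎

  sub-add-cancel : ∀ x a → (x - a) + a ≡ x
  sub-add-cancel x a = begin
    (x - a) + a      ≡⟨ +-assoc x (- a) a ⟩
    x + (- a + a)    ≡⟨ cong (x +_) (-‿inverseˡ a) ⟩
    x + 0#           ≡⟨ +-identityʳ x ⟩
    x                ∎

  sub-telescope : ∀ x a b → (x - b) + (b - a) ≡ x - a
  sub-telescope x a b = begin
    (x - b) + (b - a)      ≡⟨ +-assoc x (- b) (b - a) ⟩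
    x + (- b + (b - a))    ≡⟨ cong (x +_) (sym (+-assoc (- b) b (- a))) ⟩
    x + ((- b + b) - a)    ≡⟨ cong (λ t → x + (t - a)) (-‿inverseˡ b) ⟩
    x + (0# - a)           ≡⟨ cong (x +_) (+-identityˡ (- a)) ⟩
    x - a                  ∎

  sub-self-* : ∀ y w → (y - y) * w ≡ 0#
  sub-self-* y w = trans (cong (_* w) (-‿inverseʳ y)) (zeroˡ w)

  sumOver : List Carrier → (Carrier → Carrier) → Carrier
  sumOver xs g = foldr (λ x s → g x + s) 0# xs

  sumOver-cong : ∀ xs {g h} → (∀ x → g x ≡ h x) → sumOver xs g ≡ sumOver xs h
  sumOver-cong []       g≗h = refl
  sumOver-cong (x ∷ xs) g≗h = cong₂ _+_ (g≗h x) (sumOver-cong xs g≗h)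

  sumOver-+ : ∀ xs g h → sumOver xs (λ x → g x + h x) ≡ sumOver xs g + sumOver xs h
  sumOver-+ []       g h = sym (+-identityˡ 0#)
  sumOver-+ (x ∷ xs) g h = begin
    (g x + h x) + sumOver xs (λ x → g x + h x)     ≡⟨ cong ((g x + h x) +_) (sumOver-+ xs g h) ⟩
    (g x + h x) + (sumOver xs g + sumOver xs h)    ≡⟨ solve 4 (λ a b c d → (a :+ b) :+ (c :+ d) := (a :+ c) :+ (b :+ d)) refl (g x) (h x) _ _ ⟩
    (g x + sumOver xs g) + (h x + sumOver xs h)    ∎

  sumOver-* : ∀ xs c g → sumOver xs (λ x → c * g x) ≡ c * sumOver xs g
  sumOver-* []       c g = sym (zeroʳ c)
  sumOver-* (x ∷ xs) c g = begin
    c * g x + sumOver xs (λ x → c * g x)   ≡⟨ cong (c * g x +_) (sumOver-* xs c g) ⟩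
    c * g x + c * sumOver xs g             ≡⟨ solve 3 (λ c a b → c :* a :+ c :* b := c :* (a :+ b)) refl c (g x) _ ⟩
    c * (g x + sumOver xs g)               ∎

  sumOver-↭ : ∀ {xs ys : List Carrier} g → xs ↭ ys → sumOver xs g ≡ sumOver ys g
  sumOver-↭ {xs} {ys} g xs↭ys = begin
    sumOver xs g                 ≡⟨ foldr-map _+_ g 0# xs ⟨
    foldr _+_ 0# (map g xs)      ≡⟨ PermSetoid.foldr-commMonoid (setoid Carrier) +-isCommutativeMonoid (↭⇒↭ₛ (Perm.map⁺ g xs↭ys)) ⟩
    foldr _+_ 0# (map g ys)      ≡⟨ foldr-map _+_ g 0# ys ⟩
    sumOver ys g                 ∎

  enumerations-↭ : ∀ {xs ys : List Carrier} → Unique xs → Unique ys → (∀ x → x ∈ xs) → (∀ x → x ∈ ys) → xs ↭ ys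
  enumerations-↭ xs! ys! ∈xs ∈ys =
    ∼bag⇒↭ (unique∧set⇒bag xs! ys! (mk⇔ (λ _ → ∈ys _) (λ _ → ∈xs _)))

  sumF-translate : ∀ c g → sumF F (λ x → g (x + c)) ≡ sumF F g
  sumF-translate c g = begin
    sumF F (λ x → g (x + c))          ≡⟨ foldr-map _ (_+ c) 0# elems ⟨
    sumOver (map (_+ c) elems) g
      ≡⟨ sumOver-↭ g (enumerations-↭ translates-unique elems-unique translates-complete elems-complete) ⟩
    sumF F g                          ∎
    where
    translates-unique : Unique (map (_+ c) elems)
    translates-unique = Unique.map⁺ (∙-cancelʳ c _ _) elems-unique
    translates-complete : ∀ x → x ∈ map (_+ c) elems
    translates-complete x =
      subst (_∈ map (_+ c) elems) (sub-add-cancel x c) (∈-map⁺ (_+ c) (elems-complete (x - c)))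

  sumF-one : sumF F (λ _ → 1#) ≡ 0#
  sumF-one = identityʳ-unique (sumF F (λ x → x)) (sumF F (λ _ → 1#)) (begin
    sumF F (λ x → x) + sumF F (λ _ → 1#)    ≡⟨ sumOver-+ elems (λ x → x) (λ _ → 1#) ⟨
    sumF F (λ x → x + 1#)                   ≡⟨ sumF-translate 1# (λ x → x) ⟩
    sumF F (λ x → x)                        ∎)

  sumOver-fibre : ∀ (p h : Carrier → Carrier) y xs → (∀ x → ¬ p x ≡ y → h (p x) ≡ 0#) →
    sumOver xs (λ x → h (p x)) ≡ ℕ→F F (length (filter (λ x → p x ≟ y) xs)) * h y
  sumOver-fibre p h y []       off = sym (zeroˡ (h y))
  sumOver-fibre p h y (x ∷ xs) off with p x ≟ y
  ... | yes refl = begin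
    h (p x) + sumOver xs (λ x → h (p x))   ≡⟨ cong (h (p x) +_) (sumOver-fibre p h (p x) xs off) ⟩
    h (p x) + n * h (p x)                  ≡⟨ solve 2 (λ c n → c :+ n :* c := (con 1 :+ n) :* c) refl (h (p x)) n ⟩
    (1# + n) * h (p x)                     ∎
    where n = ℕ→F F (length (filter (λ x′ → p x′ ≟ p x) xs))
  ... | no px≢y = begin
    h (p x) + sumOver xs (λ x → h (p x))   ≡⟨ cong₂ _+_ (off x px≢y) (sumOver-fibre p h y xs off) ⟩
    0# + _                                 ≡⟨ +-identityˡ _ ⟩
    _                                      ∎

  eval-padd : ∀ p q x → eval F (padd F p q) x ≡ eval F p x + eval F q x
  eval-padd []      q       x = sym (+-identityˡ _)
  eval-padd (a ∷ p) []      x = sym (+-identityʳ _)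
  eval-padd (a ∷ p) (b ∷ q) x = begin
    (a + b) + x * eval F (padd F p q) x            ≡⟨ cong (λ t → (a + b) + x * t) (eval-padd p q x) ⟩
    (a + b) + x * (eval F p x + eval F q x)        ≡⟨ solve 5 (λ a b x P Q → (a :+ b) :+ x :* (P :+ Q) := (a :+ x :* P) :+ (b :+ x :* Q)) refl a b x _ _ ⟩
    (a + x * eval F p x) + (b + x * eval F q x)    ∎

  eval-pscale : ∀ c p x → eval F (pscale F c p) x ≡ c * eval F p x
  eval-pscale c []      x = sym (zeroʳ c)
  eval-pscale c (a ∷ p) x = begin
    c * a + x * eval F (pscale F c p) x    ≡⟨ cong (λ t → c * a + x * t) (eval-pscale c p x) ⟩
    c * a + x * (c * eval F p x)           ≡⟨ solve 4 (λ c a x P → c :* a :+ x :* (c :* P) := c :* (a :+ x :* P)) refl c a x _ ⟩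
    c * (a + x * eval F p x)               ∎

  eval-pmul : ∀ p q x → eval F (pmul F p q) x ≡ eval F p x * eval F q x
  eval-pmul []      q x = sym (zeroˡ _)
  eval-pmul (a ∷ p) q x = begin
    eval F (padd F (pscale F a q) (0# ∷ pmul F p q)) x         ≡⟨ eval-padd (pscale F a q) (0# ∷ pmul F p q) x ⟩
    eval F (pscale F a q) x + (0# + x * eval F (pmul F p q) x) ≡⟨ cong₂ (λ s t → s + (0# + x * t)) (eval-pscale a q x) (eval-pmul p q x) ⟩
    a * eval F q x + (0# + x * (eval F p x * eval F q x))      ≡⟨ solve 4 (λ a x P Q → a :* Q :+ (con 0 :+ x :* (P :* Q)) := (a :+ x :* P) :* Q) refl a x _ _ ⟩
    (a + x * eval F p x) * eval F q x                          ∎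

  eval-derivFrom-suc : ∀ i p x → eval F (derivFrom F (suc i) p) x ≡ eval F p x + eval F (derivFrom F i p) x
  eval-derivFrom-suc i []      x = sym (+-identityˡ 0#)
  eval-derivFrom-suc i (a ∷ p) x = begin
    (1# + n) * a + x * eval F (derivFrom F (suc (suc i)) p) x       ≡⟨ cong (λ t → (1# + n) * a + x * t) (eval-derivFrom-suc (suc i) p x) ⟩
    (1# + n) * a + x * (eval F p x + eval F (derivFrom F (suc i) p) x)
      ≡⟨ solve 5 (λ n a x P Q → (con 1 :+ n) :* a :+ x :* (P :+ Q) := (a :+ x :* P) :+ (n :* a :+ x :* Q)) refl n a x _ _ ⟩
    (a + x * eval F p x) + (n * a + x * eval F (derivFrom F (suc i) p) x) ∎
    where n = ℕ→F F i

  eval-derivFrom-zero : ∀ p x → eval F (derivFrom F 0 p) x ≡ x * eval F (deriv F p) x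
  eval-derivFrom-zero []      x = sym (zeroʳ x)
  eval-derivFrom-zero (a ∷ p) x = trans (cong (_+ x * eval F (derivFrom F 1 p) x) (zeroˡ a)) (+-identityˡ _)

  eval-deriv-∷ : ∀ a p x → eval F (deriv F (a ∷ p)) x ≡ eval F p x + x * eval F (deriv F p) x
  eval-deriv-∷ a p x = trans (eval-derivFrom-suc 0 p x) (cong (eval F p x +_) (eval-derivFrom-zero p x))

  eval-deriv-padd : ∀ p q x → eval F (deriv F (padd F p q)) x ≡ eval F (deriv F p) x + eval F (deriv F q) x
  eval-deriv-padd []      q       x = sym (+-identityˡ _)
  eval-deriv-padd (a ∷ p) []      x = sym (+-identityʳ _)
  eval-deriv-padd (a ∷ p) (b ∷ q) x = begin
    eval F (deriv F ((a + b) ∷ padd F p q)) x                                    ≡⟨ eval-deriv-∷ (a + b) (padd F p q) x ⟩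
    eval F (padd F p q) x + x * eval F (deriv F (padd F p q)) x                  ≡⟨ cong₂ (λ s t → s + x * t) (eval-padd p q x) (eval-deriv-padd p q x) ⟩
    (eval F p x + eval F q x) + x * (eval F (deriv F p) x + eval F (deriv F q) x)
      ≡⟨ solve 5 (λ x P Q P′ Q′ → (P :+ Q) :+ x :* (P′ :+ Q′) := (P :+ x :* P′) :+ (Q :+ x :* Q′)) refl x _ _ _ _ ⟩
    (eval F p x + x * eval F (deriv F p) x) + (eval F q x + x * eval F (deriv F q) x)
      ≡⟨ cong₂ _+_ (eval-deriv-∷ a p x) (eval-deriv-∷ b q x) ⟨
    eval F (deriv F (a ∷ p)) x + eval F (deriv F (b ∷ q)) x                      ∎

  eval-deriv-pscale : ∀ c p x → eval F (deriv F (pscale F c p)) x ≡ c * eval F (deriv F p) x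
  eval-deriv-pscale c []      x = sym (zeroʳ c)
  eval-deriv-pscale c (a ∷ p) x = begin
    eval F (deriv F ((c * a) ∷ pscale F c p)) x                         ≡⟨ eval-deriv-∷ (c * a) (pscale F c p) x ⟩
    eval F (pscale F c p) x + x * eval F (deriv F (pscale F c p)) x     ≡⟨ cong₂ (λ s t → s + x * t) (eval-pscale c p x) (eval-deriv-pscale c p x) ⟩
    c * eval F p x + x * (c * eval F (deriv F p) x)                     ≡⟨ solve 4 (λ c x P P′ → c :* P :+ x :* (c :* P′) := c :* (P :+ x :* P′)) refl c x _ _ ⟩
    c * (eval F p x + x * eval F (deriv F p) x)                         ≡⟨ cong (c *_) (eval-deriv-∷ a p x) ⟨
    c * eval F (deriv F (a ∷ p)) x                                      ∎

  eval-deriv-pmul : ∀ p q x →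
    eval F (deriv F (pmul F p q)) x ≡ eval F (deriv F p) x * eval F q x + eval F p x * eval F (deriv F q) x
  eval-deriv-pmul []      q x = sym (trans (cong₂ _+_ (zeroˡ _) (zeroˡ _)) (+-identityˡ 0#))
  eval-deriv-pmul (a ∷ p) q x = begin
    eval F (deriv F (padd F (pscale F a q) (0# ∷ pmul F p q))) x
      ≡⟨ eval-deriv-padd (pscale F a q) (0# ∷ pmul F p q) x ⟩
    eval F (deriv F (pscale F a q)) x + eval F (deriv F (0# ∷ pmul F p q)) x
      ≡⟨ cong₂ _+_ (eval-deriv-pscale a q x) (eval-deriv-∷ 0# (pmul F p q) x) ⟩
    a * Q′ + (eval F (pmul F p q) x + x * eval F (deriv F (pmul F p q)) x)
      ≡⟨ cong₂ (λ s t → a * Q′ + (s + x * t)) (eval-pmul p q x) (eval-deriv-pmul p q x) ⟩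
    a * Q′ + (P * Q + x * (P′ * Q + P * Q′))
      ≡⟨ solve 6 (λ a x P Q P′ Q′ → a :* Q′ :+ (P :* Q :+ x :* (P′ :* Q :+ P :* Q′)) := (P :+ x :* P′) :* Q :+ (a :+ x :* P) :* Q′) refl a x P Q P′ Q′ ⟩
    (P + x * P′) * Q + (a + x * P) * Q′
      ≡⟨ cong (λ t → t * Q + (a + x * P) * Q′) (eval-deriv-∷ a p x) ⟨
    eval F (deriv F (a ∷ p)) x * Q + (a + x * P) * Q′ ∎
    where
    P = eval F p x
    Q = eval F q x
    P′ = eval F (deriv F p) x
    Q′ = eval F (deriv F q) x

  linearFactor : Carrier → Poly F
  linearFactor a = (- a) ∷ 1# ∷ []

  eval-linearFactor : ∀ a x → eval F (linearFactor a) x ≡ x - a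
  eval-linearFactor a x = solve 2 (λ n x → n :+ x :* (con 1 :+ x :* con 0) := x :+ n) refl (- a) x

  eval-deriv-linearFactor : ∀ a x → eval F (deriv F (linearFactor a)) x ≡ 1#
  eval-deriv-linearFactor a x = solve 1 (λ x → (con 1 :+ con 0) :* con 1 :+ x :* con 0 := con 1) refl x

  linearFactors : List Carrier → Poly F
  linearFactors = foldr (λ y p → pmul F (linearFactor y) p) (1# ∷ [])

  ∏-sub : List Carrier → Carrier → Carrier
  ∏-sub []      z = 1#
  ∏-sub (a ∷ R) z = (z - a) * ∏-sub R z

  eval-linearFactors : ∀ R z → eval F (linearFactors R) z ≡ ∏-sub R z
  eval-linearFactors []      z = trans (cong (1# +_) (zeroʳ z)) (+-identityʳ 1#)
  eval-linearFactors (a ∷ R) z = trans (eval-pmul (linearFactor a) (linearFactors R) z)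
    (cong₂ _*_ (eval-linearFactor a z) (eval-linearFactors R z))

  ∏-sub-root : ∀ {y R} → y ∈ R → ∏-sub R y ≡ 0#
  ∏-sub-root {y} {y ∷ R} (here refl) = sub-self-* y (∏-sub R y)
  ∏-sub-root {y} {a ∷ R} (there y∈R) = trans (cong ((y - a) *_) (∏-sub-root y∈R)) (zeroʳ _)

  eval-deriv-linearFactors-∷ : ∀ a R y →
    eval F (deriv F (linearFactors (a ∷ R))) y ≡ ∏-sub R y + (y - a) * eval F (deriv F (linearFactors R)) y
  eval-deriv-linearFactors-∷ a R y = begin
    eval F (deriv F (pmul F (linearFactor a) (linearFactors R))) y
      ≡⟨ eval-deriv-pmul (linearFactor a) (linearFactors R) y ⟩
    eval F (deriv F (linearFactor a)) y * eval F (linearFactors R) y + eval F (linearFactor a) y * D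
      ≡⟨ cong₂ (λ s t → s * eval F (linearFactors R) y + t * D) (eval-deriv-linearFactor a y) (eval-linearFactor a y) ⟩
    1# * eval F (linearFactors R) y + (y - a) * D
      ≡⟨ cong (_+ (y - a) * D) (trans (*-identityˡ _) (eval-linearFactors R y)) ⟩
    ∏-sub R y + (y - a) * D ∎
    where D = eval F (deriv F (linearFactors R)) y

  eval-deriv-linearFactors : ∀ {y} R (y∈R : y ∈ R) → eval F (deriv F (linearFactors R)) y ≡ ∏-sub (R ─ y∈R) y
  eval-deriv-linearFactors {y} (y ∷ R) (here refl) = begin
    eval F (deriv F (linearFactors (y ∷ R))) y                ≡⟨ eval-deriv-linearFactors-∷ y R y ⟩
    ∏-sub R y + (y - y) * eval F (deriv F (linearFactors R)) y ≡⟨ cong (∏-sub R y +_) (sub-self-* y _) ⟩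
    ∏-sub R y + 0#                                            ≡⟨ +-identityʳ _ ⟩
    ∏-sub R y                                                 ∎
  eval-deriv-linearFactors {y} (a ∷ R) (there y∈R) = begin
    eval F (deriv F (linearFactors (a ∷ R))) y                 ≡⟨ eval-deriv-linearFactors-∷ a R y ⟩
    ∏-sub R y + (y - a) * eval F (deriv F (linearFactors R)) y ≡⟨ cong₂ (λ s t → s + (y - a) * t) (∏-sub-root y∈R) (eval-deriv-linearFactors R y∈R) ⟩
    0# + (y - a) * ∏-sub (R ─ y∈R) y                           ≡⟨ +-identityˡ _ ⟩
    (y - a) * ∏-sub (R ─ y∈R) y                                ∎

  record LinearFunctional : Set where
    field
      apply      : (Carrier → Carrier) → Carrier
      apply-cong : ∀ {g h} → (∀ z → g z ≡ h z) → apply g ≡ apply h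
      apply-+    : ∀ g h → apply (λ z → g z + h z) ≡ apply g + apply h
      apply-*    : ∀ c g → apply (λ z → c * g z) ≡ c * apply g

  open LinearFunctional

  moment : LinearFunctional → ℕ → Carrier
  moment L m = apply L (_^ m)

  reweight : LinearFunctional → (Carrier → Carrier) → LinearFunctional
  reweight L w = record
    { apply      = λ g → apply L (λ z → w z * g z)
    ; apply-cong = λ g≗h → apply-cong L (λ z → cong (w z *_) (g≗h z))
    ; apply-+    = λ g h → trans (apply-cong L (λ z → distribˡ (w z) (g z) (h z))) (apply-+ L _ _)
    ; apply-*    = λ c g → trans (apply-cong L (λ z → x∙yz≈y∙xz (w z) c (g z))) (apply-* L c _)
    }

  sumOverValues : (Carrier → Carrier) → LinearFunctional
  sumOverValues p = record
    { apply      = λ g → sumF F (λ x → g (p x))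
    ; apply-cong = λ g≗h → sumOver-cong elems (λ x → g≗h (p x))
    ; apply-+    = λ g h → sumOver-+ elems _ _
    ; apply-*    = λ c g → sumOver-* elems c _
    }

  reweight-apply : ∀ L a g → apply (reweight L (_- a)) g + a * apply L g ≡ apply L (λ z → z * g z)
  reweight-apply L a g = begin
    apply L (λ z → (z - a) * g z) + a * apply L g      ≡⟨ cong (apply L (λ z → (z - a) * g z) +_) (apply-* L a g) ⟨
    apply L (λ z → (z - a) * g z) + apply L (λ z → a * g z)  ≡⟨ apply-+ L _ _ ⟨
    apply L (λ z → (z - a) * g z + a * g z)            ≡⟨ apply-cong L (λ z → trans (sym (distribʳ (g z) (z - a) a)) (cong (_* g z) (sub-add-cancel z a))) ⟩
    apply L (λ z → z * g z)                            ∎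

  reweight-moment : ∀ L a m → moment L m ≡ 0# → moment (reweight L (_- a)) m ≡ moment L (suc m)
  reweight-moment L a m Lm≡0 = begin
    moment (reweight L (_- a)) m                       ≡⟨ +-identityʳ _ ⟨
    moment (reweight L (_- a)) m + 0#                  ≡⟨ cong (moment (reweight L (_- a)) m +_) (trans (cong (a *_) Lm≡0) (zeroʳ a)) ⟨
    moment (reweight L (_- a)) m + a * moment L m      ≡⟨ reweight-apply L a (_^ m) ⟩
    moment L (suc m)                                   ∎

  apply-∏-sub : ∀ L R → (∀ m → m < length R → moment L m ≡ 0#) → apply L (∏-sub R) ≡ moment L (length R)
  apply-∏-sub L []      _      = refl
  apply-∏-sub L (a ∷ R) vanish = begin
    apply (reweight L (_- a)) (∏-sub R)       ≡⟨ apply-∏-sub (reweight L (_- a)) R vanish′ ⟩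
    moment (reweight L (_- a)) (length R)     ≡⟨ reweight-moment L a (length R) (vanish (length R) (ℕ.n<1+n _)) ⟩
    moment L (suc (length R))                 ∎
    where
    vanish′ : ∀ m → m < length R → moment (reweight L (_- a)) m ≡ 0#
    vanish′ m m<∣R∣ = trans (reweight-moment L a m (vanish m (ℕ.m<n⇒m<1+n m<∣R∣))) (vanish (suc m) (s≤s m<∣R∣))

  reweight-distinct-roots : ∀ L {a b} g → ¬ a ≡ b →
    apply (reweight L (_- a)) g ≡ apply (reweight L (_- b)) g → apply L g ≡ 0#
  reweight-distinct-roots L {a} {b} g a≢b same = nonzero-cancelˡ b-a≢0 (identityʳ-unique _ _ (begin
    apply L (λ z → (z - b) * g z) + (b - a) * apply L g        ≡⟨ cong (apply L (λ z → (z - b) * g z) +_) (apply-* L (b - a) g) ⟨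
    apply L (λ z → (z - b) * g z) + apply L (λ z → (b - a) * g z)   ≡⟨ apply-+ L _ _ ⟨
    apply L (λ z → (z - b) * g z + (b - a) * g z)              ≡⟨ apply-cong L (λ z → trans (sym (distribʳ (g z) (z - b) (b - a))) (cong (_* g z) (sub-telescope z a b))) ⟩
    apply L (λ z → (z - a) * g z)                              ≡⟨ same ⟩
    apply L (λ z → (z - b) * g z)                              ∎))
    where
    b-a≢0 : ¬ b - a ≡ 0#
    b-a≢0 b-a≡0 = a≢b (sym (x∙y⁻¹≈ε⇒x≈y b a b-a≡0))

  ConstantOnCofactors : LinearFunctional → List Carrier → Carrier → Set
  ConstantOnCofactors L W C = ∀ {y} (y∈W : y ∈ W) → apply L (∏-sub (W ─ y∈W)) ≡ C

  LeadingMoment : LinearFunctional → ℕ → Carrier → Set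
  LeadingMoment L k C = (∀ m → m < k → moment L m ≡ 0#) × moment L k ≡ C

  leadingMoment-0 : ∀ {L L′ k C} → LeadingMoment L k C → LeadingMoment L′ k C → moment L 0 ≡ moment L′ 0
  leadingMoment-0 {k = zero}  (_ , top) (_ , top′) = trans top (sym top′)
  leadingMoment-0 {k = suc k} (low , _) (low′ , _) = trans (low 0 (s≤s z≤n)) (sym (low′ 0 (s≤s z≤n)))

  constantOnCofactors⇒leadingMoment : ∀ k L W C → Unique W → length W ≡ suc k →
    ConstantOnCofactors L W C → LeadingMoment L k C
  constantOnCofactors⇒leadingMoment zero    L (a ∷ [])    C _ _ const = (λ _ ()) , const (here refl)
  constantOnCofactors⇒leadingMoment (suc k) L (a ∷ b ∷ W) C ((a≢b ∷ a∉W) ∷ b∷W!@(_ ∷ W!)) ∣W∣≡ const =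
    low , top
    where
    Lᵃ Lᵇ : LinearFunctional
    Lᵃ = reweight L (_- a)
    Lᵇ = reweight L (_- b)
    constᵇ : ConstantOnCofactors Lᵇ (a ∷ W) C
    constᵇ (here refl)  = const (here refl)
    constᵇ (there y∈W) = trans (apply-cong L (λ z → x∙yz≈y∙xz (z - b) (z - a) _)) (const (there (there y∈W)))
    IHᵃ : LeadingMoment Lᵃ k C
    IHᵃ = constantOnCofactors⇒leadingMoment k Lᵃ (b ∷ W) C b∷W! (ℕ.suc-injective ∣W∣≡) (λ y∈ → const (there y∈))
    IHᵇ : LeadingMoment Lᵇ k C
    IHᵇ = constantOnCofactors⇒leadingMoment k Lᵇ (a ∷ W) C (a∉W ∷ W!) (ℕ.suc-injective ∣W∣≡) constᵇ
    low : ∀ m → m < suc k → moment L m ≡ 0#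
    low zero    _         = reweight-distinct-roots L (_^ 0) a≢b (leadingMoment-0 {Lᵃ} {Lᵇ} IHᵃ IHᵇ)
    low (suc m) (s≤s m<k) = trans (sym (reweight-moment L a m (low m (ℕ.m<n⇒m<1+n m<k)))) (proj₁ IHᵃ m m<k)
    top : moment L (suc k) ≡ C
    top = trans (sym (reweight-moment L a k (low k (ℕ.n<1+n k)))) (proj₂ IHᵃ)

  ∈-─⁺ : ∀ {x y} {xs : List Carrier} → x ∈ xs → ¬ x ≡ y → (y∈xs : y ∈ xs) → x ∈ xs ─ y∈xs
  ∈-─⁺ (here refl) x≢y (here refl) = contradiction refl x≢y
  ∈-─⁺ (there x∈)  _   (here _)    = x∈
  ∈-─⁺ (here x≡)   _   (there _)   = here x≡
  ∈-─⁺ (there x∈)  x≢y (there y∈)  = there (∈-─⁺ x∈ x≢y y∈)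

  valueSet-complete : ∀ f x → eval F f x ∈ valueSet F f
  valueSet-complete f x = ∈-deduplicate⁺ _≟_ (∈-map⁺ (eval F f) (elems-complete x))

  ConstantEφ′ : Poly F → Carrier → Set
  ConstantEφ′ f C = ∀ y → y ∈ valueSet F f → ℕ→F F (e F f y) * eval F (deriv F (φ F f)) y ≡ C

  e*φ′≡apply-cofactor : ∀ f {y} (y∈V : y ∈ valueSet F f) →
    ℕ→F F (e F f y) * eval F (deriv F (φ F f)) y ≡ apply (sumOverValues (eval F f)) (∏-sub (valueSet F f ─ y∈V))
  e*φ′≡apply-cofactor f {y} y∈V = begin
    ℕ→F F (e F f y) * eval F (deriv F (φ F f)) y    ≡⟨ cong (ℕ→F F (e F f y) *_) (eval-deriv-linearFactors (valueSet F f) y∈V) ⟩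
    ℕ→F F (e F f y) * ∏-sub cofactor y               ≡⟨ sumOver-fibre (eval F f) (∏-sub cofactor) y elems off-fibre ⟨
    sumF F (λ x → ∏-sub cofactor (eval F f x))       ∎
    where
    cofactor = valueSet F f ─ y∈V
    off-fibre : ∀ x → ¬ eval F f x ≡ y → ∏-sub cofactor (eval F f x) ≡ 0#
    off-fibre x fx≢y = ∏-sub-root (∈-─⁺ (valueSet-complete f x) fx≢y y∈V)

  WSC⇒constantEφ′ : ∀ f → WSC F f → ConstantEφ′ f (powerSum F f (length (valueSet F f) ∸ 1))
  WSC⇒constantEφ′ f (_ , _ , lower) y y∈V = begin
    ℕ→F F (e F f y) * eval F (deriv F (φ F f)) y      ≡⟨ e*φ′≡apply-cofactor f y∈V ⟩
    apply Λ (∏-sub (valueSet F f ─ y∈V))               ≡⟨ apply-∏-sub Λ (valueSet F f ─ y∈V) vanish ⟩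
    moment Λ (length (valueSet F f ─ y∈V))             ≡⟨ cong (moment Λ) ∣cofactor∣≡u ⟩
    powerSum F f (length (valueSet F f) ∸ 1)           ∎
    where
    Λ = sumOverValues (eval F f)
    ∣cofactor∣≡u : length (valueSet F f ─ y∈V) ≡ length (valueSet F f) ∸ 1
    ∣cofactor∣≡u = cong ℕ.pred (sym (length-removeAt′ (valueSet F f) _))
    vanish : ∀ m → m < length (valueSet F f ─ y∈V) → moment Λ m ≡ 0#
    vanish zero    _   = sumF-one
    vanish (suc m) m<∣cofactor∣ = lower (suc m) (s≤s z≤n) (subst (suc m <_) ∣cofactor∣≡u m<∣cofactor∣)

  leadingMoment⇒IsU : ∀ f k {C} → ¬ C ≡ 0# → LeadingMoment (sumOverValues (eval F f)) k C → IsU F f k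
  leadingMoment⇒IsU f zero    C≢0 (_ , top)   = contradiction (trans (sym top) sumF-one) C≢0
  leadingMoment⇒IsU f (suc k) C≢0 (low , top) =
    s≤s z≤n , (λ S≡0 → C≢0 (trans (sym top) S≡0)) , (λ m _ m<k → low m m<k)

  constantEφ′⇒WSC : ∀ f {C} → ¬ C ≡ 0# → ConstantEφ′ f C → WSC F f
  constantEφ′⇒WSC f {C} C≢0 const =
    subst (λ n → IsU F f (n ∸ 1)) (sym ∣V∣≡) (leadingMoment⇒IsU f _ C≢0
      (constantOnCofactors⇒leadingMoment _ Λ V C (deduplicate-! _≟_ _) ∣V∣≡
        (λ y∈V → trans (sym (e*φ′≡apply-cofactor f y∈V)) (const _ y∈V))))
    where
    Λ = sumOverValues (eval F f)
    V = valueSet F f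
    ∣V∣≡ : length V ≡ suc (length (V ─ valueSet-complete f 0#))
    ∣V∣≡ = length-removeAt′ V _

theorem2p1 : (F : FiniteField) (f : Poly F) →
    let open FiniteField F in
    (WSC F f ⇔ (WeaklyWSC F f × (∃[ u ] (IsU F f u × ¬ (powerSum F f u ≡ 0#) × (∀ y → y ∈ valueSet F f → ℕ→F F (e F f y) * eval F (deriv F (φ F f)) y ≡ powerSum F f u)))))
    × (WSC F f ⇔ (∃[ C ] (¬ (C ≡ 0#) × (∀ y → y ∈ valueSet F f → ℕ→F F (e F f y) * eval F (deriv F (φ F f)) y ≡ C))))
theorem2p1 F f =
    mk⇔ (λ { wsc@(1≤u , Su≢0 , _) → (_ , 1≤u , Su≢0) , _ , wsc , Su≢0 , WSC⇒constantEφ′ F f wsc })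
        (λ { (_ , _ , _ , Su≢0 , const) → constantEφ′⇒WSC F f Su≢0 const })
  , mk⇔ (λ { wsc@(_ , Su≢0 , _) → _ , Su≢0 , WSC⇒constantEφ′ F f wsc })
        (λ { (_ , C≢0 , const) → constantEφ′⇒WSC F f C≢0 const })
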